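{- Let $r\ge 0$ and let $G$ be a subdivision of a graph $H$ in which every edge of $H$ is subdivided at most $r$ times. Then $H$ is a depth-$\lceil\log_2(r+1)\rceil$ vertex minor of $G$.
   Context: Graphs are finite and simple. The local complementation $G\ast v$ complements the adjacency between every pair of distinct neighbours of $v$; for an independent set $I$, $G\ast I$ is the successive local complementation of all vertices of $I$. A depth-$0$ vertex minor of $G$ is an induced subgraph; a depth-$1$ vertex minor is an induced subgraph of $G\ast I$ for some independent set $I$ of $G$; for $c>1$, a depth-$c$ vertex minor is a depth-$1$ vertex minor of a depth-$(c-1)$ vertex minor. -}

module Defs where

open import Data.Nat using (ℕ; zero; suc; _≤_)
open import Data.Bool using (Bool; true; false; not; _∧_; _xor_)
open import Data.Fin using (Fin; _≟_)
open import Data.List using (List; []; _∷_; _++_; [_]; length; reverse; foldl)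
open import Data.List.Membership.Propositional using (_∈_)
open import Data.List.Relation.Unary.Unique.Propositional using (Unique)
open import Data.Product using (Σ; ∃; _×_; _,_)
open import Data.Sum using (_⊎_)
open import Function.Definitions using (Injective)
open import Relation.Nullary using (¬_; yes; no)
open import Relation.Nullary.Decidable using (⌊_⌋)
open import Relation.Binary.PropositionalEquality using (_≡_; refl; sym; _≢_)

record Graph (n : ℕ) : Set where
  field
    adj    : Fin n → Fin n → Bool
    adj-sym : ∀ x y → adj x y ≡ adj y x
    irrefl  : ∀ x → adj x x ≡ false
open Graph public

distinct : ∀ {n} → Fin n → Fin n → Bool
distinct x y = not ⌊ x ≟ y ⌋

distinct-sym : ∀ {n} (x y : Fin n) → distinct x y ≡ distinct y x
distinct-sym x y with x ≟ y | y ≟ x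
... | yes _ | yes _ = refl
... | no _  | no _  = refl
... | yes p | no q  with q (sym p)
...   | ()
distinct-sym x y | no p | yes q with p (sym q)
...   | ()

distinct-refl : ∀ {n} (x : Fin n) → distinct x x ≡ false
distinct-refl x with x ≟ x
... | yes _ = refl
... | no p with p refl
...   | ()

private
  ∧-comm3 : ∀ d a b → (d ∧ a ∧ b) ≡ (d ∧ b ∧ a)
  ∧-comm3 false a b = refl
  ∧-comm3 true false false = refl
  ∧-comm3 true false true = refl
  ∧-comm3 true true b = Data.Bool.Properties.∧-comm true b
    where import Data.Bool.Properties

lc-adj : ∀ {n} → Graph n → Fin n → Fin n → Fin n → Bool
lc-adj G v x y = adj G x y xor (distinct x y ∧ adj G v x ∧ adj G v y)

_*_ : ∀ {n} → Graph n → Fin n → Graph n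
adj (G * v) = lc-adj G v
adj-sym (G * v) x y
  rewrite adj-sym G x y | distinct-sym x y
        | ∧-comm3 (distinct y x) (adj G v x) (adj G v y) = refl
irrefl (G * v) x rewrite irrefl G x | distinct-refl x = refl

Independent : ∀ {n} → Graph n → List (Fin n) → Set
Independent G I = Unique I × (∀ x y → x ∈ I → y ∈ I → adj G x y ≡ false)

_*ˢ_ : ∀ {n} → Graph n → List (Fin n) → Graph n
G *ˢ I = foldl _*_ G I

InducedSubgraph : ∀ {m n} → Graph m → Graph n → Set
InducedSubgraph {m} {n} H G =
  Σ (Fin m → Fin n) λ f → Injective _≡_ _≡_ f × (∀ x y → adj H x y ≡ adj G (f x) (f y))

VM1 : ∀ {m n} → Graph m → Graph n → Set
VM1 H G = Σ _ λ I → Independent G I × InducedSubgraph H (G *ˢ I)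

DepthVM : ℕ → ∀ {m n} → Graph m → Graph n → Set
DepthVM zero H G = InducedSubgraph H G
DepthVM (suc zero) H G = VM1 H G
DepthVM (suc (suc c)) H G =
  Σ ℕ λ k → Σ (Graph k) λ K → DepthVM (suc c) K G × VM1 H K

Consecutive : ∀ {A : Set} → A → A → List A → Set
Consecutive a b xs = ∃ λ ys → ∃ λ zs → xs ≡ ys ++ (a ∷ b ∷ zs)

data IsWalk {n} (G : Graph n) : List (Fin n) → Set where
  w[]  : IsWalk G []
  w[-] : ∀ x → IsWalk G (x ∷ [])
  w∷   : ∀ {x y xs} → adj G x y ≡ true → IsWalk G (y ∷ xs) → IsWalk G (x ∷ y ∷ xs)

-- G is a subdivision of H in which every edge of H is subdivided at most r
-- times: branch vertices φ, and for each edge uv of H a path of G from φ u to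
-- φ v whose list of internal vertices P u v has length ≤ r; the paths are
-- internally disjoint, avoid the branch vertices, cover G, and G has no
-- further edges.
record Subdivision (r : ℕ) {m n} (H : Graph m) (G : Graph n) : Set where
  field
    φ        : Fin m → Fin n
    φ-inj    : Injective _≡_ _≡_ φ
    P        : (u v : Fin m) → adj H u v ≡ true → List (Fin n)
    P-len    : ∀ u v e → length (P u v e) ≤ r
    P-rev    : ∀ u v e e′ → P v u e′ ≡ reverse (P u v e)
    P-walk   : ∀ u v e → IsWalk G (φ u ∷ P u v e ++ [ φ v ])
    P-uniq   : ∀ u v e → Unique (P u v e)
    P-branch : ∀ u v e w → w ∈ P u v e → ∀ x → φ x ≢ w
    P-disj   : ∀ u v e u′ v′ e′ w → w ∈ P u v e → w ∈ P u′ v′ e′ →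
               (u ≡ u′ × v ≡ v′) ⊎ (u ≡ v′ × v ≡ u′)
    covers   : ∀ w → (∃ λ x → φ x ≡ w) ⊎
               (∃ λ u → ∃ λ v → ∃ λ e → w ∈ P u v e)
    edges    : ∀ a b → adj G a b ≡ true →
               ∃ λ u → ∃ λ v → ∃ λ e → Consecutive a b (φ u ∷ P u v e ++ [ φ v ])

{-# OPTIONS --safe #-}
-- Number the vertices of the path subdividing an edge of H by their positions 0, 1, …, L + 1.
-- The vertices at odd positions form an independent set I, and each of them is the only vertex
-- of I adjacent to both of its path neighbours. Hence G * I joins the vertices at positions 2h
-- and 2h + 2 and changes no other adjacency among the vertices at even positions and at L + 1;
-- these vertices therefore carry a subdivision of H with ⌊L/2⌋ subdivision vertices per edge,
-- and paths of length at most B become paths of length at most ⌈B/2⌉. The vertices at odd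
-- positions stay in the graph and are deleted only at the end. After ⌈log₂ (r + 1)⌉ rounds
-- every path is a single edge, and H is an induced subgraph.
module Submission where

open import Defs
open import Axiom.UniquenessOfIdentityProofs using (module Decidable⇒UIP)
open import Data.Bool using (Bool; true; false; _∧_; _xor_)
import Data.Bool.Properties as Bool
open import Data.Fin using (Fin)
import Data.Fin as Fin
import Data.Fin.Properties as Fin
open import Data.List using (List; []; _∷_; _++_; [_]; _∷ʳ_; length; reverse; filter; allFin)
open import Data.List.Membership.Propositional using (_∈_)
open import Data.List.Membership.Propositional.Properties using (∈-filter⁺; ∈-filter⁻; ∈-allFin)
open import Data.List.Properties using (length-++-comm; reverse-++; unfold-reverse; ++-assoc)
import Data.List.Relation.Unary.All as All
open import Data.List.Relation.Unary.AllPairs using (_∷_)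
open import Data.List.Relation.Unary.Any using (here; there)
open import Data.List.Relation.Unary.Unique.Propositional using (Unique)
open import Data.List.Relation.Unary.Unique.Propositional.Properties using (filter⁺; allFin⁺)
open import Data.Nat using (ℕ; zero; suc; pred; _+_; _≤_; _<_; z≤n; s≤s; _≤?_; ⌊_/2⌋; ⌈_/2⌉)
open import Data.Nat.Induction using (<-rec)
open import Data.Nat.Logarithm using (⌈log₂_⌉)
open import Data.Nat.Logarithm.Core using (⌈log2⌉-acc-irrelevant)
open import Data.Nat.Properties
  using (suc-injective; 0≢1+n; 1+n≢n; m≢1+n+m; ≤-refl; ≤-reflexive; ≤-trans; ≤-antisym; ≤-pred;
         n≤1+n; m≤n⇒m≤1+n; <⇒≤; <⇒≱; ≰⇒>; <-cmp; 1+n≰n; n≤0⇒n≡0; pred[n]≤n; anyUpTo?;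
         ⌈n/2⌉-mono; ⌈n/2⌉<n)
open import Data.Product using (Σ; _×_; _,_; proj₁; proj₂; map₂)
open import Data.Sum using (_⊎_; inj₁; inj₂)
open import Function using (_∘_)
open import Function.Definitions using (Injective)
open import Relation.Binary.Definitions using (tri<; tri≈; tri>)
open import Relation.Binary.PropositionalEquality hiding ([_])
open import Relation.Nullary using (¬_; Dec; yes; no; contradiction)
open import Relation.Nullary.Decidable using (_×-dec_; map′)

-- Arithmetic of positions

-- Unlike 2 * n, this satisfies double (suc n) = suc (suc (double n)) definitionally.
double : ℕ → ℕ
double zero    = zero
double (suc n) = suc (suc (double n))

double-injective : ∀ {i j} → double i ≡ double j → i ≡ j
double-injective {zero}  {zero}  _  = refl
double-injective {suc i} {suc j} eq = cong suc (double-injective (suc-injective (suc-injective eq)))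

double-mono-≤ : ∀ {i j} → i ≤ j → double i ≤ double j
double-mono-≤ z≤n       = z≤n
double-mono-≤ (s≤s i≤j) = s≤s (s≤s (double-mono-≤ i≤j))

n≤double : ∀ n → n ≤ double n
n≤double zero    = z≤n
n≤double (suc n) = s≤s (m≤n⇒m≤1+n (n≤double n))

odd≢double : ∀ i j → suc (double i) ≢ double j
odd≢double zero    zero    ()
odd≢double zero    (suc j) eq = 0≢1+n (suc-injective eq)
odd≢double (suc i) zero    ()
odd≢double (suc i) (suc j) eq = odd≢double i j (suc-injective (suc-injective eq))

⌊double/2⌋≡ : ∀ n → ⌊ double n /2⌋ ≡ n
⌊double/2⌋≡ zero    = refl
⌊double/2⌋≡ (suc n) = cong suc (⌊double/2⌋≡ n)

even-or-odd : ∀ n → n ≡ double ⌊ n /2⌋ ⊎ n ≡ suc (double ⌊ n /2⌋)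
even-or-odd zero          = inj₁ refl
even-or-odd (suc zero)    = inj₂ refl
even-or-odd (suc (suc n)) with even-or-odd n
... | inj₁ eq = inj₁ (cong (suc ∘ suc) eq)
... | inj₂ eq = inj₂ (cong (suc ∘ suc) eq)

double⌊n/2⌋≤n : ∀ n → double ⌊ n /2⌋ ≤ n
double⌊n/2⌋≤n zero          = z≤n
double⌊n/2⌋≤n (suc zero)    = z≤n
double⌊n/2⌋≤n (suc (suc n)) = s≤s (s≤s (double⌊n/2⌋≤n n))

≤⌊n/2⌋⇒double≤n : ∀ {i n} → i ≤ ⌊ n /2⌋ → double i ≤ n
≤⌊n/2⌋⇒double≤n {n = n} i≤ = ≤-trans (double-mono-≤ i≤) (double⌊n/2⌋≤n n)

odd≤n⇒≤⌊n/2⌋ : ∀ {j n} → suc (double j) ≤ n → j ≤ ⌊ n /2⌋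
odd≤n⇒≤⌊n/2⌋ {zero}              _               = z≤n
odd≤n⇒≤⌊n/2⌋ {suc j} {suc (suc n)} (s≤s (s≤s le)) = s≤s (odd≤n⇒≤⌊n/2⌋ le)

⌈log₂2+n⌉≡1+⌈log₂⌈2+n/2⌉⌉ : ∀ n → ⌈log₂ 2 + n ⌉ ≡ suc ⌈log₂ ⌈ 2 + n /2⌉ ⌉
⌈log₂2+n⌉≡1+⌈log₂⌈2+n/2⌉⌉ n = cong suc (⌈log2⌉-acc-irrelevant ⌈ suc (suc n) /2⌉)

-- Halving a path with L inner vertices keeps its even positions and its last position L + 1;
-- the i-th kept vertex sits at position keep L i.
keep : ℕ → ℕ → ℕ
keep L i with i ≤? ⌊ L /2⌋
... | yes _ = double i
... | no  _ = suc L

keep-≤⌊n/2⌋ : ∀ L i → i ≤ ⌊ L /2⌋ → keep L i ≡ double i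
keep-≤⌊n/2⌋ L i i≤ with i ≤? ⌊ L /2⌋
... | yes _  = refl
... | no  i≰ = contradiction i≤ i≰

keep-last : ∀ L → keep L (suc ⌊ L /2⌋) ≡ suc L
keep-last L with suc ⌊ L /2⌋ ≤? ⌊ L /2⌋
... | yes 1+h≤h = contradiction 1+h≤h 1+n≰n
... | no  _     = refl

keep-cases : ∀ L i → keep L i ≡ double i ⊎ keep L i ≡ suc L
keep-cases L i with i ≤? ⌊ L /2⌋
... | yes _ = inj₁ refl
... | no  _ = inj₂ refl

keep-≤ : ∀ L i → keep L i ≤ suc L
keep-≤ L i with i ≤? ⌊ L /2⌋
... | yes i≤ = m≤n⇒m≤1+n (≤⌊n/2⌋⇒double≤n i≤)
... | no  _  = ≤-refl

keep-step : ∀ L i → i ≤ ⌊ L /2⌋ →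
            (suc (double i) ≤ L × keep L i ≡ double i × keep L (suc i) ≡ suc (suc (double i))) ⊎
            (keep L i ≡ L × keep L (suc i) ≡ suc L)
keep-step L i i≤ with <-cmp i ⌊ L /2⌋
... | tri< 1+i≤ _ _ =
  inj₁ (<⇒≤ (≤⌊n/2⌋⇒double≤n 1+i≤) , keep-≤⌊n/2⌋ L i i≤ , keep-≤⌊n/2⌋ L (suc i) 1+i≤)
... | tri> _ _ i>  = contradiction i≤ (<⇒≱ i>)
... | tri≈ _ refl _ with even-or-odd L
...   | inj₁ even = inj₂ (trans (keep-≤⌊n/2⌋ L _ i≤) (sym even) , keep-last L)
...   | inj₂ odd  =
  inj₁ (≤-reflexive (sym odd) , keep-≤⌊n/2⌋ L _ i≤ , trans (keep-last L) (cong suc odd))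

keep-odd : ∀ L j → suc (double j) ≤ L →
           j ≤ ⌊ L /2⌋ × keep L j ≡ double j × keep L (suc j) ≡ suc (suc (double j))
keep-odd L j odd≤ with odd≤n⇒≤⌊n/2⌋ odd≤
... | j≤ with keep-step L j j≤
...   | inj₁ (_ , k₀ , k₁) = j≤ , k₀ , k₁
...   | inj₂ (k₀ , _)      =
  contradiction (subst (suc (double j) ≤_) (trans (sym k₀) (keep-≤⌊n/2⌋ L j j≤)) odd≤) 1+n≰n

keep-even-end : ∀ L h → L ≡ double h → h ≤ ⌊ L /2⌋ × keep L h ≡ L × keep L (suc h) ≡ suc L
keep-even-end _ h refl =
  ≤-reflexive (sym (⌊double/2⌋≡ h)) ,
  keep-≤⌊n/2⌋ (double h) h (≤-reflexive (sym (⌊double/2⌋≡ h))) ,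
  subst (λ k → keep (double h) (suc k) ≡ suc (double h)) (⌊double/2⌋≡ h) (keep-last (double h))

-- Unordered pairs

SamePair : ∀ {A : Set} → A → A → A → A → Set
SamePair x y u v = (x ≡ u × y ≡ v) ⊎ (x ≡ v × y ≡ u)

module _ {A : Set} where

  SamePair-sym : {x y u v : A} → SamePair x y u v → SamePair u v x y
  SamePair-sym (inj₁ (x≡u , y≡v)) = inj₁ (sym x≡u , sym y≡v)
  SamePair-sym (inj₂ (x≡v , y≡u)) = inj₂ (sym y≡u , sym x≡v)

  SamePair-trans : {x y u v w z : A} → SamePair x y u v → SamePair u v w z → SamePair x y w z
  SamePair-trans (inj₁ (p , q)) (inj₁ (r , s)) = inj₁ (trans p r , trans q s)
  SamePair-trans (inj₁ (p , q)) (inj₂ (r , s)) = inj₂ (trans p r , trans q s)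
  SamePair-trans (inj₂ (p , q)) (inj₁ (r , s)) = inj₂ (trans p s , trans q r)
  SamePair-trans (inj₂ (p , q)) (inj₂ (r , s)) = inj₁ (trans p s , trans q r)

  SamePair-left : {x y u v : A} → SamePair x y u v → x ≡ u ⊎ x ≡ v
  SamePair-left (inj₁ (x≡u , _)) = inj₁ x≡u
  SamePair-left (inj₂ (x≡v , _)) = inj₂ x≡v

  SamePair-right : {x y u v : A} → SamePair x y u v → y ≡ u ⊎ y ≡ v
  SamePair-right (inj₁ (_ , y≡v)) = inj₂ y≡v
  SamePair-right (inj₂ (_ , y≡u)) = inj₁ y≡u

  SamePair-diagonal : {x y u : A} → SamePair x y u u → x ≡ y
  SamePair-diagonal (inj₁ (x≡u , y≡u)) = trans x≡u (sym y≡u)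
  SamePair-diagonal (inj₂ (x≡u , y≡u)) = trans x≡u (sym y≡u)

  module _ {B : Set} (f : A → B) where

    SamePair-map : {x y u v : A} → SamePair x y u v → SamePair (f x) (f y) (f u) (f v)
    SamePair-map (inj₁ (x≡u , y≡v)) = inj₁ (cong f x≡u , cong f y≡v)
    SamePair-map (inj₂ (x≡v , y≡u)) = inj₂ (cong f x≡v , cong f y≡u)

    SamePair-injective : Injective _≡_ _≡_ f →
                         {x y u v : A} → SamePair (f x) (f y) (f u) (f v) → SamePair x y u v
    SamePair-injective f-inj (inj₁ (x≡u , y≡v)) = inj₁ (f-inj x≡u , f-inj y≡v)
    SamePair-injective f-inj (inj₂ (x≡v , y≡u)) = inj₂ (f-inj x≡v , f-inj y≡u)

SamePair-adj : ∀ {n} (G : Graph n) {a b x y} → SamePair a b x y → adj G a b ≡ adj G x y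
SamePair-adj G (inj₁ (refl , refl)) = refl
SamePair-adj G (inj₂ (refl , refl)) = adj-sym G _ _

SamePair-+2 : ∀ {p q} → SamePair p (2 + p) q (2 + q) → p ≡ q
SamePair-+2         (inj₁ (p≡q , _))    = p≡q
SamePair-+2 {q = q} (inj₂ (p≡2+q , 2+p≡q)) =
  contradiction (trans (sym 2+p≡q) (cong (2 +_) p≡2+q)) (m≢1+n+m q)

¬SamePair-+1-+2 : ∀ {p q} → ¬ SamePair p (suc p) q (2 + q)
¬SamePair-+1-+2 {q = q} (inj₁ (p≡q , 1+p≡2+q)) =
  1+n≢n (sym (suc-injective (trans (cong suc (sym p≡q)) 1+p≡2+q)))
¬SamePair-+1-+2 {q = q} (inj₂ (p≡2+q , 1+p≡q)) = m≢1+n+m q (trans (sym 1+p≡q) (cong suc p≡2+q))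

-- Local complementation at an independent set

adj⇒≢ : ∀ {n} (G : Graph n) {a b} → adj G a b ≡ true → a ≢ b
adj⇒≢ G {a} ab refl with trans (sym ab) (irrefl G a)
... | ()

≢⇒distinct : ∀ {n} {a b : Fin n} → a ≢ b → distinct a b ≡ true
≢⇒distinct {a = a} {b} a≢b with a Fin.≟ b
... | yes a≡b = contradiction a≡b a≢b
... | no  _   = refl

∧≡true : ∀ x y → (x ∧ y) ≡ true → x ≡ true × y ≡ true
∧≡true true true refl = refl , refl

parityOf : ∀ {n} → (Fin n → Bool) → List (Fin n) → Bool
parityOf g []       = false
parityOf g (x ∷ xs) = g x xor parityOf g xs

module _ {n} (g : Fin n → Bool) where

  parityOf-false : ∀ xs → (∀ x → x ∈ xs → g x ≡ false) → parityOf g xs ≡ false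
  parityOf-false []       _   = refl
  parityOf-false (x ∷ xs) g≡f rewrite g≡f x (here refl) = parityOf-false xs (λ y → g≡f y ∘ there)

  parityOf-true⇒∈ : ∀ xs → parityOf g xs ≡ true → Σ (Fin n) λ x → x ∈ xs × g x ≡ true
  parityOf-true⇒∈ (x ∷ xs) odd with g x in gx
  ... | true  = x , here refl , gx
  ... | false with parityOf-true⇒∈ xs odd
  ...   | y , y∈ , gy = y , there y∈ , gy

  parityOf-unique : ∀ xs → Unique xs → ∀ x₀ → x₀ ∈ xs → g x₀ ≡ true →
                    (∀ x → x ∈ xs → g x ≡ true → x ≡ x₀) → parityOf g xs ≡ true
  parityOf-unique (x ∷ xs) (x∉ ∷ _) x₀ (here refl) gx₀ only-x₀
    rewrite gx₀ | parityOf-false xs (λ y y∈ → Bool.¬-not (All.lookup x∉ y∈ ∘ sym ∘ only-x₀ y (there y∈)))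
    = refl
  parityOf-unique (x ∷ xs) (x∉ ∷ xs-unique) x₀ (there x₀∈) gx₀ only-x₀ with g x in gx
  ... | true  = contradiction (only-x₀ x (here refl) gx) (All.lookup x∉ x₀∈)
  ... | false = parityOf-unique xs xs-unique x₀ x₀∈ gx₀ (λ y → only-x₀ y ∘ there)

  parityOf-cong : ∀ {h : Fin n → Bool} xs → (∀ x → x ∈ xs → g x ≡ h x) →
                  parityOf g xs ≡ parityOf h xs
  parityOf-cong []       _   = refl
  parityOf-cong (x ∷ xs) g≡h =
    cong₂ _xor_ (g≡h x (here refl)) (parityOf-cong xs (λ y → g≡h y ∘ there))

commonNeighbour : ∀ {n} → Graph n → Fin n → Fin n → Fin n → Bool
commonNeighbour G a b x = adj G x a ∧ adj G x b

NonAdjacent : ∀ {n} → Graph n → List (Fin n) → Set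
NonAdjacent G I = ∀ x y → x ∈ I → y ∈ I → adj G x y ≡ false

adj-*-nonNeighbour : ∀ {n} (G : Graph n) {v y} → adj G v y ≡ false →
                     ∀ c → adj (G * v) y c ≡ adj G y c
adj-*-nonNeighbour G {y = y} vy c rewrite vy | Bool.∧-zeroʳ (distinct y c) =
  Bool.xor-identityʳ (adj G y c)

-- The vertices of I are pairwise non-adjacent, so complementing at one of them does not change
-- the neighbourhoods of the others.
adj-*ˢ : ∀ {n} (G : Graph n) I → NonAdjacent G I → ∀ a b →
         adj (G *ˢ I) a b ≡ adj G a b xor (distinct a b ∧ parityOf (commonNeighbour G a b) I)
adj-*ˢ G []      _     a b = sym (trans (cong (adj G a b xor_) (Bool.∧-zeroʳ _)) (Bool.xor-identityʳ _))
adj-*ˢ G (v ∷ I) I-nonadj a b = begin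
  adj ((G * v) *ˢ I) a b
    ≡⟨ adj-*ˢ (G * v) I nonadj′ a b ⟩
  adj (G * v) a b xor (d ∧ parityOf (commonNeighbour (G * v) a b) I)
    ≡⟨ cong (λ p → adj (G * v) a b xor (d ∧ p)) (parityOf-cong _ I unchanged) ⟩
  (adj G a b xor (d ∧ commonNeighbour G a b v)) xor (d ∧ parityOf (commonNeighbour G a b) I)
    ≡⟨ Bool.xor-assoc (adj G a b) _ _ ⟩
  adj G a b xor ((d ∧ commonNeighbour G a b v) xor (d ∧ parityOf (commonNeighbour G a b) I))
    ≡⟨ cong (adj G a b xor_) (sym (Bool.∧-distribˡ-xor d _ _)) ⟩
  adj G a b xor (d ∧ parityOf (commonNeighbour G a b) (v ∷ I)) ∎
  where
  open ≡-Reasoning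
  d = distinct a b
  preserved : ∀ {y} → y ∈ I → ∀ c → adj (G * v) y c ≡ adj G y c
  preserved y∈I = adj-*-nonNeighbour G (I-nonadj v _ (here refl) (there y∈I))
  nonadj′ : NonAdjacent (G * v) I
  nonadj′ x y x∈I y∈I = trans (preserved x∈I y) (I-nonadj x y (there x∈I) (there y∈I))
  unchanged : ∀ x → x ∈ I → commonNeighbour (G * v) a b x ≡ commonNeighbour G a b x
  unchanged x x∈I = cong₂ _∧_ (preserved x∈I a) (preserved x∈I b)

induced-refl : ∀ {k} (K : Graph k) → InducedSubgraph K K
induced-refl K = (λ x → x) , (λ eq → eq) , λ _ _ → refl

induced-trans : ∀ {a b c} {A : Graph a} {B : Graph b} {C : Graph c} →
                InducedSubgraph A B → InducedSubgraph B C → InducedSubgraph A C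
induced-trans (f , f-inj , f-adj) (g , g-inj , g-adj) =
  g ∘ f , f-inj ∘ g-inj , λ x y → trans (f-adj x y) (g-adj (f x) (f y))

VM1-DepthVM-trans : ∀ k {a b c} {H : Graph a} {K : Graph b} {G : Graph c} →
                    VM1 K G → DepthVM k H K → DepthVM (suc k) H G
VM1-DepthVM-trans zero {H = H} {K} {G} (I , I-ind , K⊆G*I) H⊆K =
  I , I-ind , induced-trans {A = H} {K} {G *ˢ I} H⊆K K⊆G*I
VM1-DepthVM-trans (suc zero)    K≤G H≤K                 = _ , _ , K≤G , H≤K
VM1-DepthVM-trans (suc (suc k)) K≤G (_ , _ , L≤K , H≤L) = _ , _ , VM1-DepthVM-trans (suc k) K≤G L≤K , H≤L

-- Path systems

-- Only the branch vertices and the vertices on the paths are constrained: G may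
-- contain further vertices, the ones discarded by earlier halvings.
record PathSystem (B : ℕ) {m n} (H : Graph m) (G : Graph n) : Set₁ where
  field
    Edge          : Set
    Edge-any?     : (Q : Edge → Set) → (∀ e → Dec (Q e)) → Dec (Σ Edge Q)
    source target : Edge → Fin m
    Edge-adj      : ∀ e → adj H (source e) (target e) ≡ true
    adj⇒Edge      : ∀ u v → adj H u v ≡ true → Σ Edge λ e → SamePair (source e) (target e) u v
    Edge-unique   : ∀ e e′ → SamePair (source e) (target e) (source e′) (target e′) → e ≡ e′
    φ             : Fin m → Fin n
    φ-injective   : Injective _≡_ _≡_ φ
    inner         : Edge → ℕ
    path          : Edge → ℕ → Fin n
    path-source   : ∀ e → path e 0 ≡ φ (source e)
    path-target   : ∀ e → path e (suc (inner e)) ≡ φ (target e)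
    path-length   : ∀ e → suc (inner e) ≤ B
    path-adj      : ∀ e i → i ≤ inner e → adj G (path e i) (path e (suc i)) ≡ true

  Inner : Edge → ℕ → Set
  Inner e p = 1 ≤ p × p ≤ inner e

  OnPaths : Fin n → Set
  OnPaths a = (Σ (Fin m) λ x → φ x ≡ a) ⊎
              (Σ Edge λ e → Σ ℕ λ p → p ≤ suc (inner e) × path e p ≡ a)

  field
    inner-injective  : ∀ e e′ i j → Inner e i → Inner e′ j → path e i ≡ path e′ j →
                       e ≡ e′ × i ≡ j
    inner-not-branch : ∀ e p → Inner e p → ∀ x → φ x ≢ path e p
    edges            : ∀ a b → OnPaths a → OnPaths b → adj G a b ≡ true →
                       Σ Edge λ e → Σ ℕ λ j → j ≤ inner e × SamePair (path e j) (path e (suc j)) a b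

module PathSystemProperties {B m n} {H : Graph m} {G : Graph n} (S : PathSystem B H G) where
  open PathSystem S

  End : Edge → ℕ → Set
  End e p = p ≡ 0 ⊎ p ≡ suc (inner e)

  inner-or-end : ∀ e p → p ≤ suc (inner e) → Inner e p ⊎ End e p
  inner-or-end e zero    _  = inj₂ (inj₁ refl)
  inner-or-end e (suc p) p≤ with suc p ≤? inner e
  ... | yes p≤L = inj₁ (s≤s z≤n , p≤L)
  ... | no  p≰L = inj₂ (inj₂ (≤-antisym p≤ (≰⇒> p≰L)))

  end-branch : ∀ e p → End e p → Σ (Fin m) λ x → φ x ≡ path e p
  end-branch e _ (inj₁ refl) = source e , sym (path-source e)
  end-branch e _ (inj₂ refl) = target e , sym (path-target e)

  ends-SamePair : ∀ e p q → End e p → End e q → p ≢ q →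
                  SamePair (path e p) (path e q) (φ (source e)) (φ (target e))
  ends-SamePair e _ _ (inj₁ refl) (inj₁ refl) p≢q = contradiction refl p≢q
  ends-SamePair e _ _ (inj₁ refl) (inj₂ refl) _   = inj₁ (path-source e , path-target e)
  ends-SamePair e _ _ (inj₂ refl) (inj₁ refl) _   = inj₂ (path-target e , path-source e)
  ends-SamePair e _ _ (inj₂ refl) (inj₂ refl) p≢q = contradiction refl p≢q

  φ-source≢φ-target : ∀ e → φ (source e) ≢ φ (target e)
  φ-source≢φ-target e = adj⇒≢ H (Edge-adj e) ∘ φ-injective

  inner-locate : ∀ e p e′ q → Inner e p → q ≤ suc (inner e′) → path e′ q ≡ path e p →
                 e′ ≡ e × q ≡ p
  inner-locate e p e′ q ip q≤ eq with inner-or-end e′ q q≤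
  ... | inj₁ iq  = inner-injective e′ e q p iq ip eq
  ... | inj₂ end = let x , φx≡ = end-branch e′ q end in
                   contradiction (trans φx≡ eq) (inner-not-branch e p ip x)

  path-injective : ∀ e p q → p ≤ suc (inner e) → q ≤ suc (inner e) → path e p ≡ path e q → p ≡ q
  path-injective e p q p≤ q≤ eq with inner-or-end e p p≤ | inner-or-end e q q≤
  ... | inj₁ ip | _       = sym (proj₂ (inner-locate e p e q ip q≤ (sym eq)))
  ... | _       | inj₁ iq = proj₂ (inner-locate e q e p iq p≤ eq)
  ... | inj₂ (inj₁ refl) | inj₂ (inj₁ refl) = refl
  ... | inj₂ (inj₂ refl) | inj₂ (inj₂ refl) = refl
  ... | inj₂ (inj₁ refl) | inj₂ (inj₂ refl) =
    contradiction (trans (sym (path-source e)) (trans eq (path-target e))) (φ-source≢φ-target e)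
  ... | inj₂ (inj₂ refl) | inj₂ (inj₁ refl) =
    contradiction (trans (sym (path-source e)) (trans (sym eq) (path-target e))) (φ-source≢φ-target e)

  inner-in-pair : ∀ e p e′ s t → Inner e p → s ≤ suc (inner e′) → t ≤ suc (inner e′) →
                  path e p ≡ path e′ s ⊎ path e p ≡ path e′ t → e′ ≡ e
  inner-in-pair e p e′ s t ip s≤ _  (inj₁ eq) = proj₁ (inner-locate e p e′ s ip s≤ (sym eq))
  inner-in-pair e p e′ s t ip _  t≤ (inj₂ eq) = proj₁ (inner-locate e p e′ t ip t≤ (sym eq))

  -- An inner vertex determines its path; two branch vertices determine it by Edge-unique.
  same-edge : ∀ e p q e′ s t → p ≤ suc (inner e) → q ≤ suc (inner e) →
              s ≤ suc (inner e′) → t ≤ suc (inner e′) → p ≢ q →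
              SamePair (path e p) (path e q) (path e′ s) (path e′ t) → e′ ≡ e
  same-edge e p q e′ s t p≤ q≤ s≤ t≤ p≢q same
    with inner-or-end e p p≤ | inner-or-end e q q≤ | inner-or-end e′ s s≤ | inner-or-end e′ t t≤
  ... | inj₁ ip | _ | _ | _ = inner-in-pair e p e′ s t ip s≤ t≤ (SamePair-left same)
  ... | _ | inj₁ iq | _ | _ = inner-in-pair e q e′ s t iq s≤ t≤ (SamePair-right same)
  ... | _ | _ | inj₁ is | _ = sym (inner-in-pair e′ s e p q is p≤ q≤ (SamePair-left (SamePair-sym same)))
  ... | _ | _ | _ | inj₁ it = sym (inner-in-pair e′ t e p q it p≤ q≤ (SamePair-right (SamePair-sym same)))
  ... | inj₂ ep | inj₂ eq | inj₂ es | inj₂ et =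
    sym (Edge-unique e e′ (SamePair-injective φ φ-injective
      (SamePair-trans (SamePair-sym (ends-SamePair e p q ep eq p≢q))
        (SamePair-trans same (ends-SamePair e′ s t es et s≢t)))))
    where
    s≢t : s ≢ t
    s≢t refl = p≢q (path-injective e p q p≤ q≤ (SamePair-diagonal same))

  path-SamePair : ∀ e p q e′ s t → p ≤ suc (inner e) → q ≤ suc (inner e) →
                  s ≤ suc (inner e′) → t ≤ suc (inner e′) → p ≢ q →
                  SamePair (path e p) (path e q) (path e′ s) (path e′ t) → e′ ≡ e × SamePair p q s t
  path-SamePair e p q e′ s t p≤ q≤ s≤ t≤ p≢q same
    with same-edge e p q e′ s t p≤ q≤ s≤ t≤ p≢q same
  ... | refl = refl , positions same
    where
    positions : SamePair (path e p) (path e q) (path e s) (path e t) → SamePair p q s t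
    positions (inj₁ (ps , qt)) = inj₁ (path-injective e p s p≤ s≤ ps , path-injective e q t q≤ t≤ qt)
    positions (inj₂ (pt , qs)) = inj₂ (path-injective e p t p≤ t≤ pt , path-injective e q s q≤ s≤ qs)

  OnPaths-path : ∀ e p → p ≤ suc (inner e) → OnPaths (path e p)
  OnPaths-path e p p≤ = inj₂ (e , p , p≤ , refl)

  adjacent-positions : ∀ e p q → p ≤ suc (inner e) → q ≤ suc (inner e) →
                       adj G (path e p) (path e q) ≡ true → q ≡ suc p ⊎ p ≡ suc q
  adjacent-positions e p q p≤ q≤ pq with edges _ _ (OnPaths-path e p p≤) (OnPaths-path e q q≤) pq
  ... | e′ , j , j≤ , same
    with path-SamePair e′ j (suc j) e p q (m≤n⇒m≤1+n j≤) (s≤s j≤) p≤ q≤ (1+n≢n ∘ sym) same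
  ...   | refl , inj₁ (j≡p , 1+j≡q) = inj₁ (trans (sym 1+j≡q) (cong suc j≡p))
  ...   | refl , inj₂ (j≡q , 1+j≡p) = inj₂ (trans (sym 1+j≡p) (cong suc j≡q))

  inner-neighbour : ∀ e p c → Inner e p → OnPaths c → adj G (path e p) c ≡ true →
                    c ≡ path e (pred p) ⊎ c ≡ path e (suc p)
  inner-neighbour e p c ip oc pc with edges _ _ (OnPaths-path e p (m≤n⇒m≤1+n (proj₂ ip))) oc pc
  ... | e′ , j , j≤ , inj₁ (jp , 1+jc) with inner-locate e p e′ j ip (m≤n⇒m≤1+n j≤) jp
  ...   | refl , refl = inj₂ (sym 1+jc)
  inner-neighbour e p c ip oc pc | e′ , j , j≤ , inj₂ (jc , 1+jp)
    with inner-locate e p e′ (suc j) ip (s≤s j≤) 1+jp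
  ...   | refl , refl = inj₁ (sym jc)

  inner-adjacent : ∀ e p e′ q → Inner e p → Inner e′ q → adj G (path e p) (path e′ q) ≡ true →
                   e′ ≡ e × (q ≡ pred p ⊎ q ≡ suc p)
  inner-adjacent e p e′ q ip iq pq
    with inner-neighbour e p _ ip (OnPaths-path e′ q (m≤n⇒m≤1+n (proj₂ iq))) pq
  ... | inj₁ at-p-1
    with inner-locate e′ q e (pred p) iq (m≤n⇒m≤1+n (≤-trans pred[n]≤n (proj₂ ip))) (sym at-p-1)
  ...   | refl , p-1≡q = refl , inj₁ (sym p-1≡q)
  inner-adjacent e p e′ q ip iq pq | inj₂ at-p+1
    with inner-locate e′ q e (suc p) iq (s≤s (proj₂ ip)) (sym at-p+1)
  ...   | refl , p+1≡q = refl , inj₂ (sym p+1≡q)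

  common-neighbours : ∀ e p a b → Inner e p → OnPaths a → OnPaths b → a ≢ b →
                      adj G (path e p) a ≡ true → adj G (path e p) b ≡ true →
                      SamePair a b (path e (pred p)) (path e (suc p))
  common-neighbours e p a b ip oa ob a≢b pa pb
    with inner-neighbour e p a ip oa pa | inner-neighbour e p b ip ob pb
  ... | inj₁ a≡ | inj₁ b≡ = contradiction (trans a≡ (sym b≡)) a≢b
  ... | inj₁ a≡ | inj₂ b≡ = inj₁ (a≡ , b≡)
  ... | inj₂ a≡ | inj₁ b≡ = inj₂ (a≡ , b≡)
  ... | inj₂ a≡ | inj₂ b≡ = contradiction (trans a≡ (sym b≡)) a≢b

  ≤1⇒InducedSubgraph : B ≤ 1 → InducedSubgraph H G
  ≤1⇒InducedSubgraph B≤1 = φ , φ-injective , adj-φ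
    where
    inner≡0 : ∀ e → inner e ≡ 0
    inner≡0 e = n≤0⇒n≡0 (≤-pred (≤-trans (path-length e) B≤1))

    ends : ∀ e → SamePair (path e 0) (path e 1) (φ (source e)) (φ (target e))
    ends e = inj₁ (path-source e , subst (λ L → path e (suc L) ≡ φ (target e)) (inner≡0 e) (path-target e))

    H⇒G : ∀ x y → adj H x y ≡ true → adj G (φ x) (φ y) ≡ true
    H⇒G x y xy with adj⇒Edge x y xy
    ... | e , same = trans (sym (SamePair-adj G (SamePair-trans (ends e) (SamePair-map φ same))))
                           (path-adj e 0 z≤n)

    G⇒H : ∀ x y → adj G (φ x) (φ y) ≡ true → adj H x y ≡ true
    G⇒H x y xy with edges _ _ (inj₁ (x , refl)) (inj₁ (y , refl)) xy
    ... | e , j , j≤ , same with n≤0⇒n≡0 (subst (j ≤_) (inner≡0 e) j≤)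
    ...   | refl = trans (sym (SamePair-adj H (SamePair-injective φ φ-injective
                                (SamePair-trans (SamePair-sym (ends e)) same))))
                         (Edge-adj e)

    adj-φ : ∀ x y → adj H x y ≡ adj G (φ x) (φ y)
    adj-φ x y with adj H x y in xy | adj G (φ x) (φ y) in φxy
    ... | true  | true  = refl
    ... | false | false = refl
    ... | true  | false = contradiction (trans (sym (H⇒G x y xy)) φxy) λ ()
    ... | false | true  = contradiction (trans (sym (G⇒H x y φxy)) xy) λ ()

-- Halving a path system

module Halving {B m n} {H : Graph m} {G : Graph n} (S : PathSystem B H G) where
  open PathSystem S
  open PathSystemProperties S

  OddInner : Fin n → Set
  OddInner w = Σ Edge λ e → Σ ℕ λ j → suc (double j) ≤ inner e × path e (suc (double j)) ≡ w

  OddInner? : ∀ w → Dec (OddInner w)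
  OddInner? w = Edge-any? _ λ e →
    map′ (map₂ proj₂) (λ (j , odd≤ , eq) → j , ≤-trans (s≤s (n≤double j)) odd≤ , odd≤ , eq)
      (anyUpTo? (λ j → (suc (double j) ≤? inner e) ×-dec (path e (suc (double j)) Fin.≟ w)) (inner e))

  I : List (Fin n)
  I = filter OddInner? (allFin n)

  ∈I⇒OddInner : ∀ {x} → x ∈ I → OddInner x
  ∈I⇒OddInner = proj₂ ∘ ∈-filter⁻ OddInner? {xs = allFin n}

  OddInner⇒∈I : ∀ {x} → OddInner x → x ∈ I
  OddInner⇒∈I {x} = ∈-filter⁺ OddInner? (∈-allFin x)

  I-nonAdjacent : NonAdjacent G I
  I-nonAdjacent x y x∈I y∈I with ∈I⇒OddInner x∈I | ∈I⇒OddInner y∈I | adj G x y in xy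
  ... | _ | _ | false = refl
  ... | e , j , j< , refl | e′ , j′ , j′< , refl | true
    with inner-adjacent e _ e′ _ (s≤s z≤n , j<) (s≤s z≤n , j′<) xy
  ...   | _ , inj₁ y-at-2j   = contradiction y-at-2j (odd≢double j′ j)
  ...   | _ , inj₂ y-at-2j+2 = contradiction y-at-2j+2 (odd≢double j′ (suc j))

  I-independent : Independent G I
  I-independent = filter⁺ OddInner? (allFin⁺ n) , I-nonAdjacent

  G′ : Graph n
  G′ = G *ˢ I

  adj-G′ : ∀ a b → adj G′ a b ≡ adj G a b xor (distinct a b ∧ parityOf (commonNeighbour G a b) I)
  adj-G′ = adj-*ˢ G I I-nonAdjacent

  odd-common-neighbour : ∀ {a b x} → x ∈ I → commonNeighbour G a b x ≡ true →
                         OnPaths a → OnPaths b → a ≢ b →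
                         Σ Edge λ e → Σ ℕ λ j → suc (double j) ≤ inner e ×
                           x ≡ path e (suc (double j)) ×
                           SamePair a b (path e (double j)) (path e (suc (suc (double j))))
  odd-common-neighbour {a} {b} {x} x∈I xab oa ob a≢b with ∈I⇒OddInner x∈I | ∧≡true (adj G x a) _ xab
  ... | e , j , j< , refl | xa , xb =
    e , j , j< , refl , common-neighbours e _ a b (s≤s z≤n , j<) oa ob a≢b xa xb

  -- The middle vertex of positions 2h, 2h+1, 2h+2 is their only common neighbour in I.
  bridge : ∀ e h → suc (suc (double h)) ≤ suc (inner e) →
           adj G′ (path e (double h)) (path e (suc (suc (double h)))) ≡ true
  bridge e h 2h+2≤ = trans (adj-G′ a b) (cong₂ _xor_ a≁b (cong₂ _∧_ (≢⇒distinct a≢b) odd))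
    where
    a = path e (double h)
    b = path e (suc (suc (double h)))
    mid = path e (suc (double h))
    2h≤ : double h ≤ suc (inner e)
    2h≤ = ≤-trans (n≤1+n _) (≤-trans (n≤1+n _) 2h+2≤)
    a≢b : a ≢ b
    a≢b = m≢1+n+m (double h) ∘ path-injective e _ _ 2h≤ 2h+2≤
    a≁b : adj G a b ≡ false
    a≁b = Bool.¬-not (two-apart ∘ adjacent-positions e _ _ 2h≤ 2h+2≤)
      where
      two-apart : ¬ (suc (suc (double h)) ≡ suc (double h) ⊎ double h ≡ suc (suc (suc (double h))))
      two-apart (inj₁ eq) = 1+n≢n eq
      two-apart (inj₂ eq) = m≢1+n+m (double h) eq
    only-mid : ∀ x → x ∈ I → commonNeighbour G a b x ≡ true → x ≡ mid
    only-mid x x∈I xab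
      with odd-common-neighbour x∈I xab (OnPaths-path e _ 2h≤) (OnPaths-path e _ 2h+2≤) a≢b
    ... | e′ , j , j< , refl , same
      with path-SamePair e _ _ e′ _ _ 2h≤ 2h+2≤ (m≤n⇒m≤1+n (<⇒≤ j<)) (s≤s j<)
                         (a≢b ∘ cong (path e)) same
    ...   | refl , positions = cong (path e ∘ suc) (sym (SamePair-+2 positions))
    odd : parityOf (commonNeighbour G a b) I ≡ true
    odd = parityOf-unique _ I (proj₁ I-independent) mid (OddInner⇒∈I (e , h , ≤-pred 2h+2≤ , refl))
            (cong₂ _∧_ (trans (adj-sym G mid a) (path-adj e _ (<⇒≤ (≤-pred 2h+2≤))))
                       (path-adj e _ (≤-pred 2h+2≤)))
            only-mid

  last-step : ∀ e → adj G′ (path e (inner e)) (path e (suc (inner e))) ≡ true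
  last-step e = trans (adj-G′ a b) (cong₂ _xor_ ab (trans (cong (distinct a b ∧_) even) (Bool.∧-zeroʳ _)))
    where
    a = path e (inner e)
    b = path e (suc (inner e))
    ab : adj G a b ≡ true
    ab = path-adj e (inner e) ≤-refl
    no-common : ∀ x → x ∈ I → commonNeighbour G a b x ≢ true
    no-common x x∈I xab
      with odd-common-neighbour x∈I xab (OnPaths-path e _ (n≤1+n _)) (OnPaths-path e _ ≤-refl)
                                (adj⇒≢ G ab)
    ... | e′ , j , j< , _ , same
      with path-SamePair e _ _ e′ _ _ (n≤1+n _) ≤-refl (m≤n⇒m≤1+n (<⇒≤ j<)) (s≤s j<)
                         (1+n≢n ∘ sym) same
    ...   | refl , positions = ¬SamePair-+1-+2 positions
    even : parityOf (commonNeighbour G a b) I ≡ false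
    even = parityOf-false _ I λ x x∈I → Bool.¬-not (no-common x x∈I)

  kept-path-adj : ∀ e i → i ≤ ⌊ inner e /2⌋ →
                  adj G′ (path e (keep (inner e) i)) (path e (keep (inner e) (suc i))) ≡ true
  kept-path-adj e i i≤ with keep-step (inner e) i i≤
  ... | inj₁ (odd≤ , k₀ , k₁) rewrite k₀ | k₁ = bridge e i (s≤s odd≤)
  ... | inj₂ (k₀ , k₁)        rewrite k₀ | k₁ = last-step e

  OnPaths′ : Fin n → Set
  OnPaths′ a = (Σ (Fin m) λ x → φ x ≡ a) ⊎
               (Σ Edge λ e → Σ ℕ λ p → p ≤ suc ⌊ inner e /2⌋ × path e (keep (inner e) p) ≡ a)

  OnPaths′⇒OnPaths : ∀ {a} → OnPaths′ a → OnPaths a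
  OnPaths′⇒OnPaths (inj₁ branch)           = inj₁ branch
  OnPaths′⇒OnPaths (inj₂ (e , p , _ , eq)) = inj₂ (e , keep (inner e) p , keep-≤ (inner e) p , eq)

  kept-position : ∀ e p → p ≤ suc (inner e) → OnPaths′ (path e p) →
                  (Σ ℕ λ h → p ≡ double h) ⊎ p ≡ suc (inner e)
  kept-position e p p≤ on with inner-or-end e p p≤
  ... | inj₂ (inj₁ refl) = inj₁ (0 , refl)
  ... | inj₂ (inj₂ refl) = inj₂ refl
  ... | inj₁ ip with on
  ...   | inj₁ (x , eq) = contradiction eq (inner-not-branch e p ip x)
  ...   | inj₂ (e′ , q , _ , eq)
    with inner-locate e p e′ _ ip (keep-≤ (inner e′) q) eq | keep-cases (inner e′) q
  ...     | refl , kq≡p | inj₁ kq≡2q   = inj₁ (q , trans (sym kq≡p) kq≡2q)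
  ...     | refl , kq≡p | inj₂ kq≡L+1 = inj₂ (trans (sym kq≡p) kq≡L+1)

  HalvedStep : Fin n → Fin n → Set
  HalvedStep a b = Σ Edge λ e → Σ ℕ λ h → h ≤ ⌊ inner e /2⌋ ×
                   SamePair (path e (keep (inner e) h)) (path e (keep (inner e) (suc h))) a b

  halved-step : ∀ {a b} e h {p q} → h ≤ ⌊ inner e /2⌋ →
                keep (inner e) h ≡ p → keep (inner e) (suc h) ≡ q →
                SamePair (path e p) (path e q) a b → HalvedStep a b
  halved-step e h h≤ refl refl same = e , h , h≤ , same

  -- Of two consecutive positions one is odd unless they are the last two, L = 2h and L + 1.
  kept-edge : ∀ a b → OnPaths′ a → OnPaths′ b → adj G a b ≡ true → HalvedStep a b
  kept-edge a b oa ob ab with edges a b (OnPaths′⇒OnPaths oa) (OnPaths′⇒OnPaths ob) ab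
  ... | e , j , j≤ , same
    with kept-position e j (m≤n⇒m≤1+n j≤) (kept (SamePair-left same))
       | kept-position e (suc j) (s≤s j≤) (kept (SamePair-right same))
    where
    kept : ∀ {x} → x ≡ a ⊎ x ≡ b → OnPaths′ x
    kept (inj₁ refl) = oa
    kept (inj₂ refl) = ob
  ...   | inj₂ j≡L+1      | _              = contradiction (subst (_≤ inner e) j≡L+1 j≤) 1+n≰n
  ...   | inj₁ (h , j≡2h) | inj₁ (h′ , 1+j≡2h′) =
    contradiction (trans (cong suc (sym j≡2h)) 1+j≡2h′) (odd≢double h h′)
  ...   | inj₁ (h , j≡2h) | inj₂ 1+j≡L+1
    with keep-even-end (inner e) h (trans (sym (suc-injective 1+j≡L+1)) j≡2h)
  ...     | h≤ , k₀ , k₁ =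
    halved-step e h h≤ (trans k₀ (suc-injective (sym 1+j≡L+1))) (trans k₁ (sym 1+j≡L+1)) same

  new-edge : ∀ a b → OnPaths a → OnPaths b → a ≢ b → adj G a b ≡ false → adj G′ a b ≡ true →
             HalvedStep a b
  new-edge a b oa ob a≢b a≁b ab′ with parityOf-true⇒∈ _ I odd
    where
    toggle = distinct a b ∧ parityOf (commonNeighbour G a b) I
    toggled : toggle ≡ true
    toggled = trans (sym (trans (adj-G′ a b) (cong (_xor toggle) a≁b))) ab′
    odd : parityOf (commonNeighbour G a b) I ≡ true
    odd = proj₂ (∧≡true (distinct a b) _ toggled)
  ... | x , x∈I , xab with odd-common-neighbour x∈I xab oa ob a≢b
  ...   | e , j , j< , _ , same with keep-odd (inner e) j j<
  ...     | j≤ , k₀ , k₁ = halved-step e j j≤ k₀ k₁ (SamePair-sym same)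

  halved-edges : ∀ a b → OnPaths′ a → OnPaths′ b → adj G′ a b ≡ true → HalvedStep a b
  halved-edges a b oa ob ab′ with adj G a b in ab
  ... | true  = kept-edge a b oa ob ab
  ... | false = new-edge a b (OnPaths′⇒OnPaths oa) (OnPaths′⇒OnPaths ob) (adj⇒≢ G′ ab′) ab ab′

  kept-even : ∀ e i → i ≤ ⌊ inner e /2⌋ → path e (keep (inner e) i) ≡ path e (double i)
  kept-even e i i≤ = cong (path e) (keep-≤⌊n/2⌋ (inner e) i i≤)

  double-inner : ∀ e i → 1 ≤ i × i ≤ ⌊ inner e /2⌋ → Inner e (double i)
  double-inner e i (1≤i , i≤) = ≤-trans (s≤s z≤n) (double-mono-≤ 1≤i) , ≤⌊n/2⌋⇒double≤n i≤

  halved : PathSystem ⌈ B /2⌉ H G′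
  halved = record
    { Edge             = Edge
    ; Edge-any?        = Edge-any?
    ; source           = source
    ; target           = target
    ; Edge-adj         = Edge-adj
    ; adj⇒Edge         = adj⇒Edge
    ; Edge-unique      = Edge-unique
    ; φ                = φ
    ; φ-injective      = φ-injective
    ; inner            = λ e → ⌊ inner e /2⌋
    ; path             = λ e i → path e (keep (inner e) i)
    ; path-source      = λ e → trans (kept-even e 0 z≤n) (path-source e)
    ; path-target      = λ e → trans (cong (path e) (keep-last (inner e))) (path-target e)
    ; path-length      = λ e → ⌈n/2⌉-mono (path-length e)
    ; path-adj         = kept-path-adj
    ; inner-injective  = λ e e′ i j ii ij eq →
        map₂ double-injective (inner-injective e e′ _ _ (double-inner e i ii) (double-inner e′ j ij)
          (trans (sym (kept-even e i (proj₂ ii))) (trans eq (kept-even e′ j (proj₂ ij)))))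
    ; inner-not-branch = λ e i ii x eq →
        inner-not-branch e _ (double-inner e i ii) x (trans eq (kept-even e i (proj₂ ii)))
    ; edges            = halved-edges
    }

halve : ∀ {B m n} {H : Graph m} {G : Graph n} → PathSystem B H G →
        Σ (List (Fin n)) λ I → Independent G I × PathSystem ⌈ B /2⌉ H (G *ˢ I)
halve S = I , I-independent , halved
  where open Halving S

pathSystem⇒DepthVM : ∀ B {m n} {H : Graph m} {G : Graph n} →
                     PathSystem B H G → DepthVM ⌈log₂ B ⌉ H G
pathSystem⇒DepthVM = <-rec _ λ where
  zero          _   S → PathSystemProperties.≤1⇒InducedSubgraph S z≤n
  (suc zero)    _   S → PathSystemProperties.≤1⇒InducedSubgraph S ≤-refl
  (suc (suc b)) rec {H = H} {G} S →
    let I , I-independent , S′ = halve S in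
    subst (λ k → DepthVM k H G) (sym (⌈log₂2+n⌉≡1+⌈log₂⌈2+n/2⌉⌉ b))
      (VM1-DepthVM-trans _ (I , I-independent , induced-refl (G *ˢ I)) (rec (⌈n/2⌉<n b) S′))

-- The path system of a subdivision

lookupOr : ∀ {A : Set} → A → List A → ℕ → A
lookupOr d []       _       = d
lookupOr d (x ∷ xs) zero    = x
lookupOr d (x ∷ xs) (suc i) = lookupOr d xs i

module _ {A : Set} (d : A) where

  lookupOr-++ˡ : ∀ xs ys {i} → i < length xs → lookupOr d (xs ++ ys) i ≡ lookupOr d xs i
  lookupOr-++ˡ (x ∷ xs) ys {zero}  _         = refl
  lookupOr-++ˡ (x ∷ xs) ys {suc i} (s≤s i<) = lookupOr-++ˡ xs ys i<

  lookupOr-∷ʳ : ∀ xs y → lookupOr d (xs ∷ʳ y) (length xs) ≡ y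
  lookupOr-∷ʳ []       y = refl
  lookupOr-∷ʳ (x ∷ xs) y = lookupOr-∷ʳ xs y

  lookupOr-∈ : ∀ xs {i} → i < length xs → lookupOr d xs i ∈ xs
  lookupOr-∈ (x ∷ xs) {zero}  _        = here refl
  lookupOr-∈ (x ∷ xs) {suc i} (s≤s i<) = there (lookupOr-∈ xs i<)

  lookupOr-injective : ∀ {xs i j} → Unique xs → i < length xs → j < length xs →
                       lookupOr d xs i ≡ lookupOr d xs j → i ≡ j
  lookupOr-injective {x ∷ xs} {zero}  {zero}  _          _        _        _  = refl
  lookupOr-injective {x ∷ xs} {zero}  {suc j} (x∉ ∷ _)   _        (s≤s j<) eq =
    contradiction eq (All.lookup x∉ (lookupOr-∈ xs j<))
  lookupOr-injective {x ∷ xs} {suc i} {zero}  (x∉ ∷ _)   (s≤s i<) _        eq =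
    contradiction (sym eq) (All.lookup x∉ (lookupOr-∈ xs i<))
  lookupOr-injective {x ∷ xs} {suc i} {suc j} (_ ∷ uniq) (s≤s i<) (s≤s j<) eq =
    cong suc (lookupOr-injective uniq i< j< eq)

  Consecutive⇒lookupOr : ∀ {a b} xs → Consecutive a b xs →
                         Σ ℕ λ j → suc j < length xs × lookupOr d xs j ≡ a × lookupOr d xs (suc j) ≡ b
  Consecutive⇒lookupOr _ ([]     , zs , refl) = 0 , s≤s (s≤s z≤n) , refl , refl
  Consecutive⇒lookupOr _ (y ∷ ys , zs , refl) with Consecutive⇒lookupOr _ (ys , zs , refl)
  ... | j , 1+j< , at-j , at-1+j = suc j , s≤s 1+j< , at-j , at-1+j

IsWalk-lookupOr : ∀ {n} {G : Graph n} d xs {i} → IsWalk G xs → suc i < length xs →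
                  adj G (lookupOr d xs i) (lookupOr d xs (suc i)) ≡ true
IsWalk-lookupOr d (x ∷ y ∷ xs) {zero}  (w∷ xy _)    _          = xy
IsWalk-lookupOr d (x ∷ y ∷ xs) {suc i} (w∷ _ walk) (s≤s 1+i<) = IsWalk-lookupOr d (y ∷ xs) walk 1+i<
IsWalk-lookupOr d (x ∷ [])     {zero}  (w[-] _)     (s≤s ())

Consecutive-reverse : ∀ {A : Set} {a b : A} xs → Consecutive a b xs → Consecutive b a (reverse xs)
Consecutive-reverse {a = a} {b} _ (ys , zs , refl) = reverse zs , reverse ys , (begin
  reverse (ys ++ a ∷ b ∷ zs)            ≡⟨ reverse-++ ys (a ∷ b ∷ zs) ⟩
  reverse (a ∷ b ∷ zs) ++ reverse ys    ≡⟨ cong (_++ reverse ys) (unfold-reverse a (b ∷ zs)) ⟩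
  reverse (b ∷ zs) ∷ʳ a ++ reverse ys   ≡⟨ cong (λ xs → xs ∷ʳ a ++ reverse ys) (unfold-reverse b zs) ⟩
  (reverse zs ∷ʳ b) ∷ʳ a ++ reverse ys  ≡⟨ ++-assoc (reverse zs ∷ʳ b) [ a ] (reverse ys) ⟩
  (reverse zs ∷ʳ b) ++ a ∷ reverse ys   ≡⟨ ++-assoc (reverse zs) [ b ] (a ∷ reverse ys) ⟩
  reverse zs ++ b ∷ a ∷ reverse ys      ∎)
  where open ≡-Reasoning

module FromSubdivision {r m n} {H : Graph m} {G : Graph n} (sub : Subdivision r H G) where
  open Subdivision sub renaming (edges to G-edges)

  OrientedEdge : Set
  OrientedEdge = Σ (Fin m) λ u → Σ (Fin m) λ v → u Fin.< v × adj H u v ≡ true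

  OrientedEdge-≡ : ∀ {u v} {u<v u<v′ : u Fin.< v} {uv uv′ : adj H u v ≡ true} →
                   _≡_ {A = OrientedEdge} (u , v , u<v , uv) (u , v , u<v′ , uv′)
  OrientedEdge-≡ =
    cong₂ (λ u<v uv → _ , _ , u<v , uv) (Fin.<-irrelevant _ _) (Decidable⇒UIP.≡-irrelevant Bool._≟_ _ _)

  OrientedEdge-any? : (Q : OrientedEdge → Set) → (∀ e → Dec (Q e)) → Dec (Σ OrientedEdge Q)
  OrientedEdge-any? Q Q? =
    map′ (λ (u , v , u<v , uv , q) → (u , v , u<v , uv) , q)
         (λ ((u , v , u<v , uv) , q) → u , v , u<v , uv , q)
         (Fin.any? λ u → Fin.any? λ v → edge? u v)
    where
    edge? : ∀ u v → Dec (Σ (u Fin.< v) λ u<v → Σ (adj H u v ≡ true) λ uv → Q (u , v , u<v , uv))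
    edge? u v with u Fin.<? v | adj H u v Bool.≟ true
    ... | no u≮v  | _      = no (u≮v ∘ proj₁)
    ... | yes _   | no u≁v = no (u≁v ∘ proj₁ ∘ proj₂)
    ... | yes u<v | yes uv =
      map′ (λ q → u<v , uv , q) (λ (_ , _ , q) → subst Q OrientedEdge-≡ q) (Q? (u , v , u<v , uv))

  source target : OrientedEdge → Fin m
  source (u , _)     = u
  target (_ , v , _) = v

  orient : ∀ u v → adj H u v ≡ true → Σ OrientedEdge λ e → SamePair (source e) (target e) u v
  orient u v uv with Fin.<-cmp u v
  ... | tri< u<v _ _  = (u , v , u<v , uv) , inj₁ (refl , refl)
  ... | tri> _ _ v<u  = (v , u , v<u , trans (adj-sym H v u) uv) , inj₂ (refl , refl)
  ... | tri≈ _ refl _ = contradiction refl (adj⇒≢ H uv)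

  OrientedEdge-unique : ∀ e e′ → SamePair (source e) (target e) (source e′) (target e′) → e ≡ e′
  OrientedEdge-unique (_ , _ , _ , _)   (_ , _ , _ , _)   (inj₁ (refl , refl)) = OrientedEdge-≡
  OrientedEdge-unique (_ , _ , u<v , _) (_ , _ , v<u , _) (inj₂ (refl , refl)) =
    contradiction v<u (Fin.<-asym u<v)

  fullPath : ∀ u v → adj H u v ≡ true → List (Fin n)
  fullPath u v uv = φ u ∷ P u v uv ++ [ φ v ]

  length-fullPath : ∀ u v uv → length (fullPath u v uv) ≡ suc (suc (length (P u v uv)))
  length-fullPath u v uv = cong suc (length-++-comm (P u v uv) [ φ v ])

  reverse-fullPath : ∀ u v uv vu → reverse (fullPath u v uv) ≡ fullPath v u vu
  reverse-fullPath u v uv vu = begin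
    reverse (φ u ∷ P u v uv ++ [ φ v ])   ≡⟨ unfold-reverse (φ u) (P u v uv ++ [ φ v ]) ⟩
    reverse (P u v uv ++ [ φ v ]) ∷ʳ φ u  ≡⟨ cong (_∷ʳ φ u) (reverse-++ (P u v uv) [ φ v ]) ⟩
    φ v ∷ reverse (P u v uv) ∷ʳ φ u       ≡⟨ cong (λ Q → φ v ∷ Q ∷ʳ φ u) (sym (P-rev u v uv vu)) ⟩
    φ v ∷ P v u vu ∷ʳ φ u                 ∎
    where open ≡-Reasoning

  inner : OrientedEdge → ℕ
  inner (u , v , _ , uv) = length (P u v uv)

  path : OrientedEdge → ℕ → Fin n
  path (u , v , _ , uv) = lookupOr (φ u) (fullPath u v uv)

  path-inner : ∀ u v {u<v : u Fin.< v} uv {i} → i < length (P u v uv) →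
               path (u , v , u<v , uv) (suc i) ≡ lookupOr (φ u) (P u v uv) i
  path-inner u v uv = lookupOr-++ˡ (φ u) (P u v uv) [ φ v ]

  path-adj : ∀ e i → i ≤ inner e → adj G (path e i) (path e (suc i)) ≡ true
  path-adj (u , v , _ , uv) i i≤ =
    IsWalk-lookupOr (φ u) (fullPath u v uv) (P-walk u v uv)
      (subst (suc (suc i) ≤_) (sym (length-fullPath u v uv)) (s≤s (s≤s i≤)))

  inner-injective : ∀ e e′ i j → 1 ≤ i × i ≤ inner e → 1 ≤ j × j ≤ inner e′ →
                    path e i ≡ path e′ j → e ≡ e′ × i ≡ j
  inner-injective (u , v , u<v , uv) (u′ , v′ , u′<v′ , uv′) (suc i) (suc j) (_ , i<) (_ , j<) eq
    with P-disj u v uv u′ v′ uv′ _ (lookupOr-∈ (φ u) (P u v uv) i<)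
           (subst (_∈ P u′ v′ uv′)
                  (trans (sym (path-inner u′ v′ {u′<v′} uv′ j<)) (trans (sym eq) (path-inner u v {u<v} uv i<)))
                  (lookupOr-∈ (φ u′) (P u′ v′ uv′) j<))
  ... | inj₂ (refl , refl) = contradiction u′<v′ (Fin.<-asym u<v)
  ... | inj₁ (refl , refl) with OrientedEdge-≡ {u<v = u<v} {u′<v′} {uv} {uv′}
  ...   | refl = refl , cong suc (lookupOr-injective (φ u) (P-uniq u v uv) i< j<
                   (trans (sym (path-inner u v {u<v} uv i<)) (trans eq (path-inner u v {u<v} uv j<))))

  inner-not-branch : ∀ e p → 1 ≤ p × p ≤ inner e → ∀ x → φ x ≢ path e p
  inner-not-branch (u , v , u<v , uv) (suc p) (_ , p<) x eq =
    P-branch u v uv _ (lookupOr-∈ (φ u) (P u v uv) p<) x (trans eq (path-inner u v {u<v} uv p<))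

  step-position : ∀ {a b} u v (u<v : u Fin.< v) uv → Consecutive a b (fullPath u v uv) →
                  Σ ℕ λ j → j ≤ length (P u v uv) ×
                    path (u , v , u<v , uv) j ≡ a × path (u , v , u<v , uv) (suc j) ≡ b
  step-position u v u<v uv consecutive with Consecutive⇒lookupOr (φ u) _ consecutive
  ... | j , 1+j< , at-j , at-1+j =
    j , ≤-pred (≤-pred (subst (suc (suc j) ≤_) (length-fullPath u v uv) 1+j<)) , at-j , at-1+j

  edges : ∀ a b → adj G a b ≡ true →
          Σ OrientedEdge λ e → Σ ℕ λ j → j ≤ inner e × SamePair (path e j) (path e (suc j)) a b
  edges a b ab with G-edges a b ab
  ... | u , v , uv , consecutive with Fin.<-cmp u v
  ...   | tri< u<v _ _ =
    let j , j≤ , at-j , at-1+j = step-position u v u<v uv consecutive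
    in (u , v , u<v , uv) , j , j≤ , inj₁ (at-j , at-1+j)
  ...   | tri> _ _ v<u =
    let vu = trans (adj-sym H v u) uv
        j , j≤ , at-j , at-1+j = step-position v u v<u vu
          (subst (Consecutive b a) (reverse-fullPath u v uv vu) (Consecutive-reverse _ consecutive))
    in (v , u , v<u , vu) , j , j≤ , inj₂ (at-j , at-1+j)
  ...   | tri≈ _ refl _ = contradiction refl (adj⇒≢ H uv)

  pathSystem : PathSystem (suc r) H G
  pathSystem = record
    { Edge             = OrientedEdge
    ; Edge-any?        = OrientedEdge-any?
    ; source           = source
    ; target           = target
    ; Edge-adj         = λ (_ , _ , _ , uv) → uv
    ; adj⇒Edge         = orient
    ; Edge-unique      = OrientedEdge-unique
    ; φ                = φ
    ; φ-injective      = φ-inj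
    ; inner            = inner
    ; path             = path
    ; path-source      = λ _ → refl
    ; path-target      = λ (u , v , _ , uv) → lookupOr-∷ʳ (φ u) (P u v uv) (φ v)
    ; path-length      = λ (u , v , _ , uv) → s≤s (P-len u v uv)
    ; path-adj         = path-adj
    ; inner-injective  = inner-injective
    ; inner-not-branch = inner-not-branch
    ; edges            = λ a b _ _ → edges a b
    }

lemma14 : (r : ℕ) → ∀ {m n} (H : Graph m) (G : Graph n) →
          Subdivision r H G → DepthVM ⌈log₂ suc r ⌉ H G
lemma14 r H G sub = pathSystem⇒DepthVM (suc r) (FromSubdivision.pathSystem sub)
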